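{- Let $n\ge1$ and $p\ge n$ be integers and let $z_0\le z_1\le\dots\le z_p=n$ be integers. Then the number of vectors $\mathbf a\in\mathbb N^n$ with $(z_0(\mathbf a),z_1(\mathbf a),\dots,z_p(\mathbf a))=(z_0,z_1,\dots,z_p)$ is $n!$.
   Context: $\mathbb N=\{1,2,3,\dots\}$, $[n]=\{1,\dots,n\}$. For $\mathbf a=(a_1,\dots,a_n)\in\mathbb N^n$ and an integer $k$, the $k$-center $Z_k(\mathbf a)$ is the largest subset $X=\{x_1,\dots,x_q\}$ of $[n]$ with $x_q<x_{q-1}<\dots<x_1$ such that $a_{x_j}\le k+j$ for every $j\in[q]$, and $z_k(\mathbf a)=|Z_k(\mathbf a)|$. -}

module Defs where

open import Data.Nat using (ℕ; zero; suc; _+_; _≤_; _>_)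
open import Data.Fin using (Fin; toℕ)
open import Data.Fin.Base using () renaming (_>_ to _>ᶠ_)
open import Data.Vec using (Vec; lookup)
open import Data.List using (List; []; _∷_; length)
open import Data.List.Relation.Unary.Linked using (Linked)
open import Data.Product using (Σ; _×_; ∃)
open import Data.Unit using (⊤)
open import Relation.Binary.PropositionalEquality using (_≡_)

-- Indices of [n] = {1,…,n} are represented by Fin n (i ↦ i-1), which preserves order.
-- A vector a ∈ ℕ^n is a Vec ℕ n (positivity of entries is imposed separately).

CenterCond : ∀ {n} → ℕ → Vec ℕ n → ℕ → List (Fin n) → Set
CenterCond k a j []       = ⊤
CenterCond k a j (x ∷ xs) = (lookup a x ≤ k + j) × CenterCond k a (suc j) xs

-- A set X = {x_1 > x_2 > … > x_q} ⊆ [n], given as its strictly decreasing list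
-- [x_1, x_2, …, x_q], is admissible for the k-center if a_{x_j} ≤ k + j for all j ∈ [q].
Admissible : ∀ {n} → ℕ → Vec ℕ n → List (Fin n) → Set
Admissible k a xs = Linked _>ᶠ_ xs × CenterCond k a 1 xs

IsCenterSize : ∀ {n} → ℕ → Vec ℕ n → ℕ → Set
IsCenterSize k a m =
  (Σ (List _) λ xs → Admissible k a xs × length xs ≡ m)
  × (∀ xs → Admissible k a xs → length xs ≤ m)

{-# OPTIONS --safe #-}

-- Computing z_k greedily from the first coordinate on, a₁ enters the k-center exactly for the
-- k ≥ m, where m is least with a₁ ≤ m + z_m, and removing a₁ lowers z_k by one for those k.
-- Writing a₁ = y + m with 1 ≤ y ≤ n, m is also the least k with y ≤ z_k, so the profile and y
-- determine a₁, while the remaining entries may be any vector with the lowered profile. With n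
-- choices of y at every step, a profile is attained by exactly n! vectors.
module Submission where

open import Defs
open import Data.Nat using (ℕ; suc; _≤_)
open import Data.Nat using (_!)
open import Data.Fin as Fin using (Fin; toℕ; inject₁; fromℕ)
open import Data.Vec using (Vec)
open import Data.Vec.Relation.Unary.All using (All)
open import Data.List using (List; length)
open import Data.List.Membership.Propositional using (_∈_)
open import Data.List.Relation.Unary.Unique.Propositional using (Unique)
open import Data.Product using (Σ; _×_)
open import Function.Bundles using (_⇔_)
open import Relation.Binary.PropositionalEquality using (_≡_)

open import Data.Nat
  using (zero; _+_; _∸_; _*_; _<_; pred; z≤n; s≤s; z<s; s<s; s<s⁻¹; _≤′_; ≤′-refl; ≤′-step; >-nonZero)
open import Data.Nat.Properties
open import Data.Fin using () renaming (_>_ to _>ᶠ_)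
open import Data.Fin.Properties using (toℕ-fromℕ)
open import Data.Vec using ([]; _∷_; lookup; head)
open import Data.Vec.Properties using (∷-injective; ∷-injectiveʳ)
open import Data.Vec.Relation.Unary.All using ([]; _∷_)
open import Data.List using ([]; _∷_; [_]; map; _∷ʳ_; concat; applyUpTo)
open import Data.List.Properties using (length-map; length-++)
open import Data.List.Membership.Propositional.Properties
  using (∈-map⁺; ∈-map⁻; ∈-concat⁺′; ∈-concat⁻′; ∈-applyUpTo⁺; ∈-applyUpTo⁻)
open import Data.List.Relation.Unary.Any using (here)
open import Data.List.Relation.Unary.All using ([])
import Data.List.Relation.Unary.All.Properties as ListAll
open import Data.List.Relation.Unary.AllPairs using ([]; _∷_)
import Data.List.Relation.Unary.AllPairs.Properties as AllPairs
open import Data.List.Relation.Unary.Linked as Linked using (Linked; []; [-]; _∷_)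
open import Data.List.Relation.Unary.Linked.Properties using (map⁺; map⁻)
import Data.List.Relation.Unary.Unique.Propositional.Properties as Unique
open import Data.List.Relation.Binary.Disjoint.Propositional using (Disjoint)
open import Data.Product using (_,_; proj₁; proj₂)
open import Data.Product.Function.NonDependent.Propositional using (_×-⇔_)
open import Data.Unit using (tt)
open import Function using (_∘_)
open import Function.Bundles using (mk⇔; Equivalence)
import Function.Properties.Equivalence as ⇔
open import Relation.Binary.Core using (_Preserves_⟶_)
open import Relation.Nullary using (Dec; yes; no; ¬_; contradiction)
open import Relation.Binary.PropositionalEquality using (refl; sym; trans; cong; cong₂; subst)

open Equivalence using (to; from)

-- z_k computed greedily from the first coordinate on: if a₁ is in the k-center X,
-- it is the last element x_q, so the test is a₁ ≤ k + q with q = 1 + |X ∖ {1}|.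
center : ∀ {n} → ℕ → Vec ℕ n → ℕ
center k [] = 0
center k (x ∷ xs) with x ≤? k + suc (center k xs)
... | yes _ = suc (center k xs)
... | no  _ = center k xs

module _ {n k x : ℕ} {xs : Vec ℕ n} where

  center-included : x ≤ k + suc (center k xs) → center k (x ∷ xs) ≡ suc (center k xs)
  center-included x≤ with x ≤? k + suc (center k xs)
  ... | yes _  = refl
  ... | no x≰ = contradiction x≤ x≰

  center-excluded : k + suc (center k xs) < x → center k (x ∷ xs) ≡ center k xs
  center-excluded x> with x ≤? k + suc (center k xs)
  ... | yes x≤ = contradiction x≤ (<⇒≱ x>)
  ... | no  _  = refl

  center-≤-∷ : center k xs ≤ center k (x ∷ xs)
  center-≤-∷ with x ≤? k + suc (center k xs)
  ... | yes _ = n≤1+n _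
  ... | no  _ = ≤-refl

  center∷≡⇒included : ∀ {z} → center k (x ∷ xs) ≡ z → x ≤ k + z → suc (center k xs) ≡ z
  center∷≡⇒included eq x≤ with x ≤? k + suc (center k xs)
  ... | yes _  = eq
  ... | no x≰ = contradiction (≤-trans x≤ (+-monoʳ-≤ k (≤-trans (≤-reflexive (sym eq)) (n≤1+n _)))) x≰

  center∷≡⇒excluded : ∀ {z} → center k (x ∷ xs) ≡ z → ¬ x ≤ k + z → center k xs ≡ z × k + suc z < x
  center∷≡⇒excluded eq x≰ with x ≤? k + suc (center k xs)
  ... | yes x≤ = contradiction (subst (λ c → x ≤ k + c) eq x≤) x≰
  ... | no x≰′ = eq , subst (λ c → k + suc c < x) eq (≰⇒> x≰′)

center-≤-length : ∀ {n} k (a : Vec ℕ n) → center k a ≤ n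
center-≤-length k [] = z≤n
center-≤-length k (x ∷ xs) with x ≤? k + suc (center k xs)
... | yes _ = s≤s (center-≤-length k xs)
... | no  _ = m≤n⇒m≤1+n (center-≤-length k xs)

module _ {n} (k x : ℕ) (a : Vec ℕ n) where

  centerCond-map-suc⇔ : ∀ j ys → CenterCond k (x ∷ a) j (map Fin.suc ys) ⇔ CenterCond k a j ys
  centerCond-map-suc⇔ j []       = ⇔.refl
  centerCond-map-suc⇔ j (y ∷ ys) = ⇔.refl ×-⇔ centerCond-map-suc⇔ (suc j) ys

centerCond-∷ʳ⇔ : ∀ {n} k (a : Vec ℕ n) j xs z →
  CenterCond k a j (xs ∷ʳ z) ⇔ (CenterCond k a j xs × lookup a z ≤ k + (j + length xs))
centerCond-∷ʳ⇔ k a j [] z = mk⇔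
  (λ (le , _) → tt , subst (λ i → lookup a z ≤ k + i) (sym (+-identityʳ j)) le)
  (λ (_ , le) → subst (λ i → lookup a z ≤ k + i) (+-identityʳ j) le , tt)
centerCond-∷ʳ⇔ k a j (x ∷ xs) z = mk⇔
  (λ (le , c) → let (c′ , le′) = to ih c in (le , c′) , subst (λ i → lookup a z ≤ k + i) shift le′)
  (λ ((le , c) , le′) → le , from ih (c , subst (λ i → lookup a z ≤ k + i) (sym shift) le′))
  where
  ih = centerCond-∷ʳ⇔ k a (suc j) xs z
  shift : suc j + length xs ≡ j + suc (length xs)
  shift = sym (+-suc j (length xs))

centerCond-mono : ∀ {n k k′} {a : Vec ℕ n} {j} xs → k ≤ k′ → CenterCond k a j xs → CenterCond k′ a j xs
centerCond-mono []       k≤k′ _       = tt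
centerCond-mono (x ∷ xs) k≤k′ (le , c) = ≤-trans le (+-monoˡ-≤ _ k≤k′) , centerCond-mono xs k≤k′ c

linked-map-suc⇔ : ∀ {n} {ys : List (Fin n)} → Linked _>ᶠ_ (map Fin.suc ys) ⇔ Linked _>ᶠ_ ys
linked-map-suc⇔ = mk⇔ (Linked.map s<s⁻¹ ∘ map⁻) (map⁺ ∘ Linked.map s<s)

linked-∷ʳ⁻ : ∀ {A : Set} {R : A → A → Set} {x} xs → Linked R (xs ∷ʳ x) → Linked R xs
linked-∷ʳ⁻ []           _         = []
linked-∷ʳ⁻ (x ∷ [])     _         = [-]
linked-∷ʳ⁻ (x ∷ y ∷ xs) (r ∷ rs) = r ∷ linked-∷ʳ⁻ (y ∷ xs) rs

linked-map-suc-∷ʳ-zero : ∀ {n} {ys : List (Fin n)} →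
                         Linked _>ᶠ_ ys → Linked _>ᶠ_ (map Fin.suc ys ∷ʳ Fin.zero)
linked-map-suc-∷ʳ-zero {ys = []}          _        = [-]
linked-map-suc-∷ʳ-zero {ys = y ∷ []}      _        = z<s ∷ [-]
linked-map-suc-∷ʳ-zero {ys = y ∷ y′ ∷ ys} (r ∷ rs) = s<s r ∷ linked-map-suc-∷ʳ-zero rs

data ZeroView {n} : List (Fin (suc n)) → Set where
  avoidsZero : ∀ ys → ZeroView (map Fin.suc ys)
  endsAtZero : ∀ ys → ZeroView (map Fin.suc ys ∷ʳ Fin.zero)

zeroView : ∀ {n} (l : List (Fin (suc n))) → Linked _>ᶠ_ l → ZeroView l
zeroView []                   _        = avoidsZero []
zeroView (Fin.zero ∷ [])      _        = endsAtZero []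
zeroView (Fin.zero ∷ _ ∷ _)   (() ∷ _)
zeroView (Fin.suc i ∷ l)      lk with zeroView l (Linked.tail lk)
... | avoidsZero ys = avoidsZero (i ∷ ys)
... | endsAtZero ys = endsAtZero (i ∷ ys)

module _ {n} {k x : ℕ} {a : Vec ℕ n} {ys : List (Fin n)} where

  admissible-map-suc⇔ : Admissible k (x ∷ a) (map Fin.suc ys) ⇔ Admissible k a ys
  admissible-map-suc⇔ = linked-map-suc⇔ ×-⇔ centerCond-map-suc⇔ k x a 1 ys

  admissible-map-suc-∷ʳ-zero⇔ :
    Admissible k (x ∷ a) (map Fin.suc ys ∷ʳ Fin.zero) ⇔ (Admissible k a ys × x ≤ k + suc (length ys))
  admissible-map-suc-∷ʳ-zero⇔ = mk⇔
    (λ (lk , c) → let (c′ , x≤) = to (centerCond-∷ʳ⇔ k (x ∷ a) 1 (map Fin.suc ys) Fin.zero) c in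
      (to linked-map-suc⇔ (linked-∷ʳ⁻ (map Fin.suc ys) lk) , to (centerCond-map-suc⇔ k x a 1 ys) c′) ,
      subst (λ ℓ → x ≤ k + suc ℓ) (length-map Fin.suc ys) x≤)
    (λ ((lk , c) , x≤) → linked-map-suc-∷ʳ-zero lk ,
      from (centerCond-∷ʳ⇔ k (x ∷ a) 1 (map Fin.suc ys) Fin.zero)
        (from (centerCond-map-suc⇔ k x a 1 ys) c ,
         subst (λ ℓ → x ≤ k + suc ℓ) (sym (length-map Fin.suc ys)) x≤))

length-∷ʳ : ∀ {A : Set} (xs : List A) z → length (xs ∷ʳ z) ≡ suc (length xs)
length-∷ʳ xs z = trans (length-++ xs) (+-comm (length xs) 1)

length-map-suc-∷ʳ-zero : ∀ {n} (ys : List (Fin n)) → length (map Fin.suc ys ∷ʳ Fin.zero) ≡ suc (length ys)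
length-map-suc-∷ʳ-zero ys = trans (length-∷ʳ (map Fin.suc ys) Fin.zero) (cong suc (length-map Fin.suc ys))

center-admissible : ∀ {n} k (a : Vec ℕ n) → Σ (List (Fin n)) λ xs → Admissible k a xs × length xs ≡ center k a
center-admissible k [] = [] , ([] , tt) , refl
center-admissible k (x ∷ a) with center-admissible k a | x ≤? k + suc (center k a)
... | ys , adm , len | yes x≤ =
  map Fin.suc ys ∷ʳ Fin.zero ,
  from admissible-map-suc-∷ʳ-zero⇔ (adm , subst (λ ℓ → x ≤ k + suc ℓ) (sym len) x≤) ,
  trans (length-map-suc-∷ʳ-zero ys) (cong suc len)
... | ys , adm , len | no _ =
  map Fin.suc ys , from admissible-map-suc⇔ adm , trans (length-map Fin.suc ys) len

center-maximal : ∀ {n} k (a : Vec ℕ n) xs → Admissible k a xs → length xs ≤ center k a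
center-maximal k []      []      _ = z≤n
center-maximal k (x ∷ a) l adm with zeroView l (proj₁ adm)
... | avoidsZero ys = begin
  length (map Fin.suc ys) ≡⟨ length-map Fin.suc ys ⟩
  length ys               ≤⟨ center-maximal k a ys (to admissible-map-suc⇔ adm) ⟩
  center k a              ≤⟨ center-≤-∷ {x = x} {xs = a} ⟩
  center k (x ∷ a)        ∎
  where open ≤-Reasoning
... | endsAtZero ys = begin
  length (map Fin.suc ys ∷ʳ Fin.zero) ≡⟨ length-map-suc-∷ʳ-zero ys ⟩
  suc (length ys)                     ≤⟨ s≤s ys≤ ⟩
  suc (center k a)                    ≡⟨ center-included (≤-trans x≤ (+-monoʳ-≤ k (s≤s ys≤))) ⟨
  center k (x ∷ a)                    ∎
  where
  open ≤-Reasoning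
  adm′ = to admissible-map-suc-∷ʳ-zero⇔ adm
  x≤ = proj₂ adm′
  ys≤ : length ys ≤ center k a
  ys≤ = center-maximal k a ys (proj₁ adm′)

center-isCenterSize : ∀ {n} k (a : Vec ℕ n) → IsCenterSize k a (center k a)
center-isCenterSize k a = center-admissible k a , center-maximal k a

isCenterSize⇒≡center : ∀ {n k m} {a : Vec ℕ n} → IsCenterSize k a m → center k a ≡ m
isCenterSize⇒≡center {k = k} {a = a} ((xs , adm , len) , maximal) =
  let (ys , adm′ , len′) = center-admissible k a in
  ≤-antisym (subst (_≤ _) len′ (maximal ys adm′)) (subst (_≤ center k a) len (center-maximal k a xs adm))

center-mono : ∀ {n k k′} (a : Vec ℕ n) → k ≤ k′ → center k a ≤ center k′ a
center-mono {k = k} {k′} a k≤k′ =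
  let (xs , (lk , c) , len) = center-admissible k a in
  subst (_≤ center k′ a) len (center-maximal k′ a xs (lk , centerCond-mono xs k≤k′ c))

-- The least k ≤ p such that P holds on all of [k, p); for upward closed P with P p it is the
-- least witness.
least : {P : ℕ → Set} → (∀ k → Dec (P k)) → ℕ → ℕ
least P? zero = zero
least P? (suc p) with P? p
... | yes _ = least P? p
... | no  _ = suc p

module _ {P : ℕ → Set} (P? : ∀ k → Dec (P k)) where

  least-≤ : ∀ p → least P? p ≤ p
  least-≤ zero = z≤n
  least-≤ (suc p) with P? p
  ... | yes _ = m≤n⇒m≤1+n (least-≤ p)
  ... | no  _ = ≤-refl

  least-antitone : ∀ {Q : ℕ → Set} (Q? : ∀ k → Dec (Q k)) → (∀ {k} → Q k → P k) →
                   ∀ p → least P? p ≤ least Q? p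
  least-antitone Q? Q⇒P zero = z≤n
  least-antitone Q? Q⇒P (suc p) with P? p | Q? p
  ... | yes _ | yes _ = least-antitone Q? Q⇒P p
  ... | yes _ | no  _ = m≤n⇒m≤1+n (least-≤ p)
  ... | no ¬P | yes Q = contradiction (Q⇒P Q) ¬P
  ... | no  _ | no  _ = ≤-refl

  least-≤⇔ : (∀ {j k} → j ≤ k → P j → P k) → ∀ {p} → P p → ∀ k → least P? p ≤ k ⇔ P k
  least-≤⇔ up {zero} P0 k = mk⇔ (λ _ → up z≤n P0) (λ _ → z≤n)
  least-≤⇔ up {suc p} Psp k with P? p
  ... | yes Pp = least-≤⇔ up Pp k
  ... | no ¬Pp = mk⇔ (λ p<k → up p<k Psp) (λ Pk → ≰⇒> (λ k≤p → ¬Pp (up k≤p Pk)))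

≤⇔≤⇒≡ : ∀ {m m′} → (∀ k → m ≤ k ⇔ m′ ≤ k) → m ≡ m′
≤⇔≤⇒≡ {m} {m′} ≤⇔ = ≤-antisym (from (≤⇔ m′) ≤-refl) (to (≤⇔ m) ≤-refl)

record Profile (p n : ℕ) (Z : ℕ → ℕ) : Set where
  field
    monotone : Z Preserves _≤_ ⟶ _≤_
    stable   : ∀ {k} → p ≤ k → Z k ≡ n

threshold : ℕ → (ℕ → ℕ) → ℕ → ℕ
threshold p Z y = least (λ k → y ≤? Z k) p

threshold-mono : ∀ p Z {y y′} → y ≤ y′ → threshold p Z y ≤ threshold p Z y′
threshold-mono p Z y≤y′ = least-antitone _ _ (≤-trans y≤y′) p

module _ {p n : ℕ} {Z : ℕ → ℕ} (prof : Profile p n Z) where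
  open Profile prof

  threshold-≤⇔ : ∀ {y} → y ≤ n → ∀ k → threshold p Z y ≤ k ⇔ y ≤ Z k
  threshold-≤⇔ {y} y≤n = least-≤⇔ (λ k → y ≤? Z k) (λ j≤k y≤Zj → ≤-trans y≤Zj (monotone j≤k))
    (subst (y ≤_) (sym (stable ≤-refl)) y≤n)

  threshold-≤ : ∀ {y} → y ≤ n → threshold p Z y ≤ p
  threshold-≤ y≤n = from (threshold-≤⇔ y≤n p) (subst (_ ≤_) (sym (stable ≤-refl)) y≤n)

lowerFrom : ℕ → (ℕ → ℕ) → ℕ → ℕ
lowerFrom m Z k with m ≤? k
... | yes _ = pred (Z k)
... | no  _ = Z k

module _ {m k : ℕ} {Z : ℕ → ℕ} where

  lowerFrom-≥ : m ≤ k → lowerFrom m Z k ≡ pred (Z k)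
  lowerFrom-≥ m≤k with m ≤? k
  ... | yes _  = refl
  ... | no m≰k = contradiction m≤k m≰k

  lowerFrom-< : k < m → lowerFrom m Z k ≡ Z k
  lowerFrom-< k<m with m ≤? k
  ... | yes m≤k = contradiction m≤k (<⇒≱ k<m)
  ... | no  _   = refl

lowerFrom-profile : ∀ {p n Z y} → Profile p (suc n) Z → y ≤ suc n → Profile p n (lowerFrom (threshold p Z y) Z)
lowerFrom-profile {p} {n} {Z} {y} prof y≤ = record { monotone = mono ; stable = stable′ }
  where
  open Profile prof
  m = threshold p Z y
  mono : lowerFrom m Z Preserves _≤_ ⟶ _≤_
  mono {j} {k} j≤k with m ≤? j | m ≤? k
  ... | yes _   | yes _   = pred-mono-≤ (monotone j≤k)
  ... | yes m≤j | no m≰k  = contradiction (≤-trans m≤j j≤k) m≰k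
  ... | no m≰j  | yes m≤k = <⇒≤pred (<-≤-trans (≰⇒> (m≰j ∘ from (threshold-≤⇔ prof y≤ j)))
                                                (to (threshold-≤⇔ prof y≤ k) m≤k))
  ... | no _    | no _    = monotone j≤k
  stable′ : ∀ {k} → p ≤ k → lowerFrom m Z k ≡ n
  stable′ p≤k = trans (lowerFrom-≥ (≤-trans (threshold-≤ prof y≤) p≤k)) (cong pred (stable p≤k))

HasCenters : ∀ {n} → Vec ℕ n → (ℕ → ℕ) → Set
HasCenters a Z = ∀ k → center k a ≡ Z k

centers-∷ : ∀ {p n Z y} {xs : Vec ℕ n} → Profile p (suc n) Z → 1 ≤ y → y ≤ suc n →
            HasCenters xs (lowerFrom (threshold p Z y) Z) → HasCenters (y + threshold p Z y ∷ xs) Z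
centers-∷ {p} {n} {Z} {y} {xs} prof 1≤y y≤ hc k with threshold p Z y ≤? k
... | yes m≤k = trans (center-included y+m≤) included
  where
  y≤Zk = to (threshold-≤⇔ prof y≤ k) m≤k
  included : suc (center k xs) ≡ Z k
  included = trans (cong suc (trans (hc k) (lowerFrom-≥ m≤k)))
                   (suc-pred (Z k) {{>-nonZero (≤-trans 1≤y y≤Zk)}})
  y+m≤ : y + threshold p Z y ≤ k + suc (center k xs)
  y+m≤ = subst (λ z → y + threshold p Z y ≤ k + z) (sym included)
                (subst (y + threshold p Z y ≤_) (+-comm (Z k) k) (+-mono-≤ y≤Zk m≤k))
... | no m≰k = trans (center-excluded x>) excluded
  where
  Zk<y = ≰⇒> (m≰k ∘ from (threshold-≤⇔ prof y≤ k))
  excluded : center k xs ≡ Z k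
  excluded = trans (hc k) (lowerFrom-< (≰⇒> m≰k))
  x> : k + suc (center k xs) < y + threshold p Z y
  x> = subst (λ c → k + suc c < y + threshold p Z y) (sym excluded)
             (subst (suc k + suc (Z k) ≤_) (+-comm (threshold p Z y) y) (+-mono-≤ (≰⇒> m≰k) Zk<y))

-- x lies in the k-center of x ∷ xs exactly for k ≥ m, and m is the threshold of y = x ∸ m.
module FirstEntry {p n : ℕ} {Z : ℕ → ℕ} {x : ℕ} {xs : Vec ℕ n}
                  (prof : Profile p (suc n) Z) (1≤x : 1 ≤ x) (hc : HasCenters (x ∷ xs) Z) where
  open Profile prof

  included-at-p : x ≤ p + Z p
  included-at-p with x ≤? p + Z p
  ... | yes x≤ = x≤
  ... | no x≰ = contradiction (subst (_≤ n) (trans (proj₁ (center∷≡⇒excluded (hc p) x≰)) (stable ≤-refl))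
                                     (center-≤-length p xs)) (n≮n n)

  m : ℕ
  m = least (λ k → x ≤? k + Z k) p

  m-≤⇔ : ∀ k → m ≤ k ⇔ x ≤ k + Z k
  m-≤⇔ = least-≤⇔ _ (λ j≤k x≤ → ≤-trans x≤ (+-mono-≤ j≤k (monotone j≤k))) included-at-p

  excluded-below : ∀ {k} → k < m → center k xs ≡ Z k × k + suc (Z k) < x
  excluded-below {k} k<m = center∷≡⇒excluded (hc k) (<⇒≱ k<m ∘ from (m-≤⇔ k))

  y : ℕ
  y = x ∸ m

  Z-below : ∀ {k} → k < m → Z k < y
  Z-below {k} k<m = m+n≤o⇒m≤o∸n (suc (Z k)) (begin
    suc (Z k) + m            ≡⟨ +-comm (suc (Z k)) m ⟩
    m + suc (Z k)            ≡⟨ cong (_+ suc (Z k)) m≡ ⟨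
    suc (pred m) + suc (Z k) ≤⟨ +-monoʳ-≤ (suc (pred m)) (s≤s (monotone (<⇒≤pred k<m))) ⟩
    suc (pred m) + suc (Z (pred m)) ≤⟨ proj₂ (excluded-below (≤-reflexive m≡)) ⟩
    x                        ∎)
    where
    open ≤-Reasoning
    m≡ : suc (pred m) ≡ m
    m≡ = suc-pred m {{>-nonZero (≤-<-trans z≤n k<m)}}

  1≤y : 1 ≤ y
  1≤y with 0 <? m
  ... | yes 0<m = ≤-trans (s≤s z≤n) (Z-below 0<m)
  ... | no 0≮m = subst (λ i → 1 ≤ x ∸ i) (sym (n≤0⇒n≡0 (≮⇒≥ 0≮m))) 1≤x

  y≤Zm : y ≤ Z m
  y≤Zm = m≤n+o⇒m∸n≤o x m (to (m-≤⇔ m) ≤-refl)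

  y≤ : y ≤ suc n
  y≤ = ≤-trans y≤Zm (≤-trans (monotone (from (m-≤⇔ p) included-at-p)) (≤-reflexive (stable ≤-refl)))

  threshold≡m : threshold p Z y ≡ m
  threshold≡m = ≤⇔≤⇒≡ λ k → ⇔.trans (threshold-≤⇔ prof y≤ k)
    (mk⇔ (λ y≤Zk → ≮⇒≥ (λ k<m → <⇒≱ (Z-below k<m) y≤Zk))
         (λ m≤k → ≤-trans y≤Zm (monotone m≤k)))

  x≡ : x ≡ y + m
  x≡ = sym (m∸n+n≡m {x} {m} (≮⇒≥ λ x<m →
         contradiction (subst (1 ≤_) (m≤n⇒m∸n≡0 (<⇒≤ x<m)) 1≤y) λ ()))

  centers-tail : HasCenters xs (lowerFrom m Z)
  centers-tail k with m ≤? k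
  ... | yes m≤k = cong pred (center∷≡⇒included (hc k) (to (m-≤⇔ k) m≤k))
  ... | no m≰k  = proj₁ (excluded-below (≰⇒> m≰k))

centers-∷⁻ : ∀ {p n Z x} {xs : Vec ℕ n} → Profile p (suc n) Z → 1 ≤ x → HasCenters (x ∷ xs) Z →
             Σ ℕ λ y → 1 ≤ y × y ≤ suc n × x ≡ y + threshold p Z y ×
                       HasCenters xs (lowerFrom (threshold p Z y) Z)
centers-∷⁻ {Z = Z} {x} {xs} prof 1≤x hc =
  y , 1≤y , y≤ ,
  subst (λ t → x ≡ y + t) (sym threshold≡m) x≡ ,
  subst (λ t → HasCenters xs (lowerFrom t Z)) (sym threshold≡m) centers-tail
  where open FirstEntry prof 1≤x hc

vectorsWithProfile : (p n : ℕ) → (ℕ → ℕ) → List (Vec ℕ n)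
withRank : (p n : ℕ) → (ℕ → ℕ) → ℕ → List (Vec ℕ (suc n))

vectorsWithProfile p zero    Z = [ [] ]
vectorsWithProfile p (suc n) Z = concat (applyUpTo (withRank p n Z ∘ suc) (suc n))

withRank p n Z y = map (y + threshold p Z y ∷_) (vectorsWithProfile p n (lowerFrom (threshold p Z y) Z))

length-concat-applyUpTo : ∀ {A : Set} (f : ℕ → List A) {c} → (∀ i → length (f i) ≡ c) →
                          ∀ m → length (concat (applyUpTo f m)) ≡ m * c
length-concat-applyUpTo f eq zero    = refl
length-concat-applyUpTo f eq (suc m) =
  trans (length-++ (f 0)) (cong₂ _+_ (eq 0) (length-concat-applyUpTo (f ∘ suc) (eq ∘ suc) m))

length-vectorsWithProfile : ∀ p n Z → length (vectorsWithProfile p n Z) ≡ n !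
length-vectorsWithProfile p zero    Z = refl
length-vectorsWithProfile p (suc n) Z =
  length-concat-applyUpTo (withRank p n Z ∘ suc) (length-withRank ∘ suc) (suc n)
  where
  length-withRank : ∀ y → length (withRank p n Z y) ≡ n !
  length-withRank y = trans (length-map (y + threshold p Z y ∷_) (vectorsWithProfile p n _))
                            (length-vectorsWithProfile p n (lowerFrom (threshold p Z y) Z))

∈-map-∷⇔ : ∀ {n} {h x : ℕ} {xs : Vec ℕ n} {l} → x ∷ xs ∈ map (h ∷_) l ⇔ (x ≡ h × xs ∈ l)
∈-map-∷⇔ {h = h} = mk⇔
  (λ mem → let (t , t∈ , eq) = ∈-map⁻ (h ∷_) mem; (x≡ , xs≡) = ∷-injective eq in
           x≡ , subst (_∈ _) (sym xs≡) t∈)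
  (λ { (refl , xs∈) → ∈-map⁺ (h ∷_) xs∈ })

vectorsWithProfile-unique : ∀ p n Z → Unique (vectorsWithProfile p n Z)
vectorsWithProfile-unique p zero    Z = [] ∷ []
vectorsWithProfile-unique p (suc n) Z =
  Unique.concat⁺ (ListAll.applyUpTo⁺₂ (withRank p n Z ∘ suc) (suc n) (withRank-unique ∘ suc))
                 (AllPairs.applyUpTo⁺₁ (withRank p n Z ∘ suc) (suc n) disjoint)
  where
  withRank-unique : ∀ y → Unique (withRank p n Z y)
  withRank-unique y = Unique.map⁺ ∷-injectiveʳ (vectorsWithProfile-unique p n (lowerFrom (threshold p Z y) Z))
  head-∈-withRank : ∀ {y} {v : Vec ℕ (suc n)} → v ∈ withRank p n Z y → head v ≡ y + threshold p Z y
  head-∈-withRank {v = x ∷ xs} mem = proj₁ (to ∈-map-∷⇔ mem)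
  disjoint : ∀ {i j} → i < j → j < suc n → Disjoint (withRank p n Z (suc i)) (withRank p n Z (suc j))
  disjoint i<j _ (v∈ , v∈′) = <⇒≢ (+-mono-<-≤ (s<s i<j) (threshold-mono p Z (s≤s (<⇒≤ i<j))))
                                   (trans (sym (head-∈-withRank v∈)) (head-∈-withRank v∈′))

∈-vectorsWithProfile-suc⇔ : ∀ {p n Z} {a : Vec ℕ (suc n)} →
  a ∈ vectorsWithProfile p (suc n) Z ⇔ Σ ℕ λ y → 1 ≤ y × y ≤ suc n × a ∈ withRank p n Z y
∈-vectorsWithProfile-suc⇔ {p} {n} {Z} = mk⇔
  (λ mem → let (vs , a∈ , vs∈) = ∈-concat⁻′ (applyUpTo (withRank p n Z ∘ suc) (suc n)) mem
               (i , i< , vs≡) = ∈-applyUpTo⁻ (withRank p n Z ∘ suc) vs∈ in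
           suc i , s≤s z≤n , i< , subst (_ ∈_) vs≡ a∈)
  (λ { (suc i , _ , y≤ , a∈) → ∈-concat⁺′ a∈ (∈-applyUpTo⁺ (withRank p n Z ∘ suc) y≤) })

∈-vectorsWithProfile⇔ : ∀ {p n Z} → Profile p n Z → ∀ (a : Vec ℕ n) →
                        a ∈ vectorsWithProfile p n Z ⇔ (All (1 ≤_) a × HasCenters a Z)
∈-vectorsWithProfile⇔ {p} {zero} {Z} prof [] = mk⇔ (λ _ → [] , centers-[]) (λ _ → here refl)
  where
  open Profile prof
  centers-[] : HasCenters [] Z
  centers-[] k = sym (n≤0⇒n≡0 (≤-trans (monotone (m≤n+m k p)) (≤-reflexive (stable (m≤m+n p k)))))
∈-vectorsWithProfile⇔ {p} {suc n} {Z} prof (x ∷ xs) = mk⇔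
  (λ mem → let (y , 1≤y , y≤ , mem′) = to ∈-vectorsWithProfile-suc⇔ mem
               (x≡ , xs∈) = to ∈-map-∷⇔ mem′
               (pos , hc) = to (∈-vectorsWithProfile⇔ (lowerFrom-profile prof y≤) xs) xs∈ in
           subst (1 ≤_) (sym x≡) (≤-trans 1≤y (m≤m+n y _)) ∷ pos ,
           subst (λ x → HasCenters (x ∷ xs) Z) (sym x≡) (centers-∷ prof 1≤y y≤ hc))
  (λ { (1≤x ∷ pos , hc) →
    let (y , 1≤y , y≤ , x≡ , hc′) = centers-∷⁻ prof 1≤x hc in
    from ∈-vectorsWithProfile-suc⇔
      (y , 1≤y , y≤ ,
       from ∈-map-∷⇔ (x≡ , from (∈-vectorsWithProfile⇔ (lowerFrom-profile prof y≤) xs) (pos , hc′))) })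

stepwise⇒monotone : ∀ {f : ℕ → ℕ} → (∀ k → f k ≤ f (suc k)) → f Preserves _≤_ ⟶ _≤_
stepwise⇒monotone {f} step {j} j≤k = go (≤⇒≤′ j≤k)
  where
  go : ∀ {k} → j ≤′ k → f j ≤ f k
  go ≤′-refl      = ≤-refl
  go (≤′-step j≤k) = ≤-trans (go j≤k) (step _)

clamp : (p : ℕ) → ℕ → Fin (suc p)
clamp zero    k       = Fin.zero
clamp (suc p) zero    = Fin.zero
clamp (suc p) (suc k) = Fin.suc (clamp p k)

clamp-toℕ : ∀ p (i : Fin (suc p)) → clamp p (toℕ i) ≡ i
clamp-toℕ zero    Fin.zero    = refl
clamp-toℕ (suc p) Fin.zero    = refl
clamp-toℕ (suc p) (Fin.suc i) = cong Fin.suc (clamp-toℕ p i)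

toℕ-clamp : ∀ {p k} → k ≤ p → toℕ (clamp p k) ≡ k
toℕ-clamp {zero}  {zero}  _         = refl
toℕ-clamp {suc p} {zero}  _         = refl
toℕ-clamp {suc p} {suc k} (s≤s k≤p) = cong suc (toℕ-clamp k≤p)

clamp-≥ : ∀ {p k} → p ≤ k → clamp p k ≡ fromℕ p
clamp-≥ {zero}          _         = refl
clamp-≥ {suc p} {suc k} (s≤s p≤k) = cong Fin.suc (clamp-≥ p≤k)

clamp-stepwise : ∀ {p} (f : Fin (suc p) → ℕ) → (∀ i → f (inject₁ i) ≤ f (Fin.suc i)) →
                 ∀ k → f (clamp p k) ≤ f (clamp p (suc k))
clamp-stepwise {zero}        f step k       = ≤-refl
clamp-stepwise {suc zero}    f step zero    = step Fin.zero
clamp-stepwise {suc (suc p)} f step zero    = step Fin.zero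
clamp-stepwise {suc p}       f step (suc k) = clamp-stepwise (f ∘ Fin.suc) (step ∘ Fin.suc) k

module _ {p n : ℕ} (zs : Fin (suc p) → ℕ) (zs-last : zs (fromℕ p) ≡ n) where

  clamp-profile : (∀ i → zs (inject₁ i) ≤ zs (Fin.suc i)) → Profile p n (zs ∘ clamp p)
  clamp-profile step = record
    { monotone = stepwise⇒monotone (clamp-stepwise zs step)
    ; stable   = λ p≤k → trans (cong zs (clamp-≥ p≤k)) zs-last
    }

  hasCenters-clamp⇔ : ∀ (a : Vec ℕ n) →
                      HasCenters a (zs ∘ clamp p) ⇔ (∀ k → IsCenterSize (toℕ k) a (zs k))
  hasCenters-clamp⇔ a = mk⇔ isCenterSizes centers
    where
    isCenterSizes : HasCenters a (zs ∘ clamp p) → ∀ k → IsCenterSize (toℕ k) a (zs k)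
    isCenterSizes hc k = subst (IsCenterSize (toℕ k) a) (trans (hc (toℕ k)) (cong zs (clamp-toℕ p k)))
                               (center-isCenterSize (toℕ k) a)
    center-p : (∀ k → IsCenterSize (toℕ k) a (zs k)) → center p a ≡ n
    center-p sizes = trans (subst (λ i → center i a ≡ zs (fromℕ p)) (toℕ-fromℕ p)
                                  (isCenterSize⇒≡center (sizes (fromℕ p))))
                           zs-last
    centers : (∀ k → IsCenterSize (toℕ k) a (zs k)) → HasCenters a (zs ∘ clamp p)
    centers sizes k with k ≤? p
    ... | yes k≤p = subst (λ i → center i a ≡ zs (clamp p k)) (toℕ-clamp k≤p)
                          (isCenterSize⇒≡center (sizes (clamp p k)))
    ... | no k≰p  = let p≤k = <⇒≤ (≰⇒> k≰p) in
      trans (≤-antisym (center-≤-length k a) (subst (_≤ center k a) (center-p sizes) (center-mono a p≤k)))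
            (sym (trans (cong zs (clamp-≥ p≤k)) zs-last))

mainTheorem4 : (n p : ℕ) → 1 ≤ n → n ≤ p →
    (zs : Fin (suc p) → ℕ) →
    (∀ (i : Fin p) → zs (inject₁ i) ≤ zs (Fin.suc i)) →
    zs (fromℕ p) ≡ n →
    Σ (List (Vec ℕ n)) λ L →
      Unique L × length L ≡ n ! ×
      (∀ (a : Vec ℕ n) →
        (a ∈ L) ⇔ (All (1 ≤_) a × (∀ (k : Fin (suc p)) → IsCenterSize (toℕ k) a (zs k))))
mainTheorem4 n p _ _ zs step zs-last =
  vectorsWithProfile p n Z ,
  vectorsWithProfile-unique p n Z ,
  length-vectorsWithProfile p n Z ,
  λ a → ⇔.trans (∈-vectorsWithProfile⇔ (clamp-profile zs zs-last step) a)
                (⇔.refl ×-⇔ hasCenters-clamp⇔ zs zs-last a)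
  where
  Z : ℕ → ℕ
  Z = zs ∘ clamp p
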